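{- Let $(\mathbb{X},\leqq)$ be a relational model with respect to $K$, and let $\ast_c$ be the choice revision on $K$ determined by it. Then for all finite $A,B\subseteq\mathcal{L}$: (1) $\mathrm{Cn}(K\ast_c A)=K\ast_c A$; (2) $K\ast_c A=K$ or $A\cap(K\ast_c A)\neq\emptyset$; (3) if $A\cap(K\ast_c B)\neq\emptyset$, then $A\cap(K\ast_c A)\neq\emptyset$; (4) if $A\cap K\neq\emptyset$, then $K\ast_c A=K$; (5) if $(K\ast_c A)\cap B\neq\emptyset$ and $(K\ast_c B)\cap A\neq\emptyset$, then $K\ast_c A=K\ast_c B$.
   Context: $\mathcal{L}$ is a propositional language generated by a set of propositional variables with $\neg,\wedge,\vee,\rightarrow$. $\mathrm{Cn}$ is a consequence operation on $\mathcal{L}$ that is supraclassical, compact and satisfies the deduction property ($\varphi\in\mathrm{Cn}(A\cup\{\psi\})$ iff $\psi\rightarrow\varphi\in\mathrm{Cn}(A)$). A belief set is a set $X\subseteq\mathcal{L}$ with $X=\mathrm{Cn}(X)$. $K$ is a fixed consistent belief set. A choice revision on $K$ is a function $\ast_c$ assigning to each finite $A\subseteq\mathcal{L}$ a set $K\ast_c A\subseteq\mathcal{L}$. A relational model with respect to $K$ is a pair $(\mathbb{X},\leqq)$ where $\mathbb{X}$ is a set of belief sets with $K\in\mathbb{X}$, $\leqq$ is a binary relation on $\mathbb{X}$ with $K\leqq X$ for every $X\in\mathbb{X}$, and for every condition of the form considered, whenever the set of elements of $\mathbb{X}$ satisfying it is nonempty it has a unique $\leqq$-minimal element; in particular, for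 every nonempty finite $A$, if $\mathbb{X}_A=\{X\in\mathbb{X}\mid X\cap A\neq\emptyset\}$ is nonempty it has a unique $\leqq$-minimal element, denoted $\min(\mathbb{X}_A)$. (In the paper's terms, $X\cap A\neq\emptyset$ is exactly satisfaction of the belief descriptor $\{\mathfrak{B}\varphi_0\vee\cdots\vee\mathfrak{B}\varphi_n\}$ for $A=\{\varphi_0,\dots,\varphi_n\}$; the uniqueness-of-minimum requirement holds for all such descriptors, i.e. all sets of truth-functional combinations of atoms $\mathfrak{B}\varphi$, where $X$ satisfies $\mathfrak{B}\varphi$ iff $\varphi\in X$.) The choice revision determined by $(\mathbb{X},\leqq)$ is: $K\ast_c A=\min(\mathbb{X}_A)$ if $A\neq\emptyset$ and $\mathbb{X}_A\neq\emptyset$, and $K\ast_c A=K$ otherwise. -}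

module Defs where

open import Data.Bool using (Bool; true; false; not; _∧_; _∨_)
open import Data.List using (List; [])
open import Data.List.Membership.Propositional using (_∈_)
open import Data.Product using (Σ; ∃; _×_; _,_)
open import Data.Sum using (_⊎_)
open import Relation.Nullary using (¬_)
open import Relation.Binary.PropositionalEquality using (_≡_)

data Formula (Var : Set) : Set where
  var  : Var → Formula Var
  ~_   : Formula Var → Formula Var
  _&_  : Formula Var → Formula Var → Formula Var
  _∣_  : Formula Var → Formula Var → Formula Var
  _⇒_  : Formula Var → Formula Var → Formula Var

module _ {Var : Set} where

  FSet : Set₁
  FSet = Formula Var → Set

  _⊆_ : FSet → FSet → Set
  X ⊆ Y = ∀ φ → X φ → Y φ

  _≐_ : FSet → FSet → Set
  X ≐ Y = (X ⊆ Y) × (Y ⊆ X)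

  _∪_ : FSet → FSet → FSet
  (X ∪ Y) φ = X φ ⊎ Y φ

  ｛_｝ : Formula Var → FSet
  ｛ ψ ｝ φ = φ ≡ ψ

  ⟪_⟫ : List (Formula Var) → FSet
  ⟪ L ⟫ φ = φ ∈ L

  ⟦_⟧ : Formula Var → (Var → Bool) → Bool
  ⟦ var p ⟧ v = v p
  ⟦ ~ φ ⟧ v = not (⟦ φ ⟧ v)
  ⟦ φ & ψ ⟧ v = ⟦ φ ⟧ v ∧ ⟦ ψ ⟧ v
  ⟦ φ ∣ ψ ⟧ v = ⟦ φ ⟧ v ∨ ⟦ ψ ⟧ v
  ⟦ φ ⇒ ψ ⟧ v = not (⟦ φ ⟧ v) ∨ ⟦ ψ ⟧ v

  Cn₀ : FSet → FSet
  Cn₀ A φ = ∀ (v : Var → Bool) → (∀ ψ → A ψ → ⟦ ψ ⟧ v ≡ true) → ⟦ φ ⟧ v ≡ true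

  record IsConsequence (Cn : FSet → FSet) : Set₁ where
    field
      inclusion     : ∀ A → A ⊆ Cn A
      monotony      : ∀ A B → A ⊆ B → Cn A ⊆ Cn B
      iteration     : ∀ A → Cn (Cn A) ⊆ Cn A
      supraclassical : ∀ A → Cn₀ A ⊆ Cn A
      compact       : ∀ A φ → Cn A φ →
                        Σ (List (Formula Var)) λ L → (⟪ L ⟫ ⊆ A) × Cn ⟪ L ⟫ φ
      deduction₁    : ∀ A ψ φ → Cn (A ∪ ｛ ψ ｝) φ → Cn A (ψ ⇒ φ)
      deduction₂    : ∀ A ψ φ → Cn A (ψ ⇒ φ) → Cn (A ∪ ｛ ψ ｝) φ

  BeliefSet : (FSet → FSet) → FSet → Set
  BeliefSet Cn X = X ≐ Cn X

  Consistent : FSet → Set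
  Consistent K = ¬ (∀ φ → K φ)

  data Desc : Set where
    𝔅    : Formula Var → Desc
    ¬ᵈ   : Desc → Desc
    _∧ᵈ_ : Desc → Desc → Desc
    _∨ᵈ_ : Desc → Desc → Desc
    _→ᵈ_ : Desc → Desc → Desc

  _⊩_ : FSet → Desc → Set
  X ⊩ 𝔅 φ = X φ
  X ⊩ ¬ᵈ d = ¬ (X ⊩ d)
  X ⊩ (d ∧ᵈ e) = (X ⊩ d) × (X ⊩ e)
  X ⊩ (d ∨ᵈ e) = (X ⊩ d) ⊎ (X ⊩ e)
  X ⊩ (d →ᵈ e) = (X ⊩ d) → (X ⊩ e)

  _⊩ˢ_ : FSet → (Desc → Set) → Set
  X ⊩ˢ Ψ = ∀ d → Ψ d → X ⊩ d

  -- X ∩ A ≠ ∅ for a finite set A (given as a list)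
  Meets : List (Formula Var) → FSet → Set
  Meets A X = ∃ λ φ → (φ ∈ A) × X φ

module _ {W : Set} (_≤_ : W → W → Set) where

  _<_ : W → W → Set
  x < y = (x ≤ y) × ¬ (y ≤ x)

  Minimal : (W → Set) → W → Set
  Minimal S x = S x × (∀ y → S y → ¬ (y < x))

  HasUniqueMin : (W → Set) → Set
  HasUniqueMin S = Σ W λ x → Minimal S x × (∀ y → Minimal S y → y ≡ x)

-- A relational model w.r.t. K. The set 𝕏 of belief sets is represented
-- by an index type W together with an injective (up to set equality)
-- map 𝕏 : W → FSet; the relation ≤ lives on W.
record RelModel {Var : Set} (Cn : FSet {Var} → FSet) (K : FSet {Var}) : Set₁ where
  field
    W        : Set
    𝕏        : W → FSet {Var}
    _≤_      : W → W → Set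
    injective : ∀ w w' → 𝕏 w ≐ 𝕏 w' → w ≡ w'
    belief   : ∀ w → BeliefSet Cn (𝕏 w)
    k        : W
    𝕏k≐K     : 𝕏 k ≐ K
    k-least  : ∀ w → k ≤ w
    uniqueMin : ∀ (Ψ : Desc → Set) → (∃ λ w → 𝕏 w ⊩ˢ Ψ) →
                  HasUniqueMin _≤_ (λ w → 𝕏 w ⊩ˢ Ψ)

  𝕏[_] : List (Formula Var) → W → Set
  𝕏[ A ] w = Meets A (𝕏 w)

record DeterminedBy {Var : Set} {Cn : FSet {Var} → FSet} {K : FSet {Var}}
         (M : RelModel Cn K) (∗ : List (Formula Var) → FSet {Var}) : Set₁ where
  open RelModel M
  field
    case-min  : ∀ A → ¬ (A ≡ []) → ∀ w → Minimal _≤_ 𝕏[ A ] w → ∗ A ≐ 𝕏 w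
    case-else : ∀ A → (A ≡ [] ⊎ ¬ (∃ λ w → 𝕏[ A ] w)) → ∗ A ≐ K

-- Every revision K ∗ A is an element of 𝕏 (either K itself or the minimum of 𝕏_A), which gives
-- closure, and whenever A meets some element of 𝕏 the revision is the minimum of 𝕏_A.
-- Confirmation holds because K is the least element, so it is the minimum of 𝕏_A as soon
-- as it meets A. For reciprocity, the minima of 𝕏_A and 𝕏_B both lie in 𝕏_A ∩ 𝕏_B and are
-- minimal there; this intersection is described by a belief descriptor, so its minimal
-- element is unique.
module Submission where

open import Defs
open import Level using (0ℓ)
open import Axiom.ExcludedMiddle using (ExcludedMiddle)
open import Data.Empty using (⊥-elim)
open import Data.List using (List; []; _∷_)
open import Data.List.Relation.Unary.Any using (here; there)
open import Data.Product using (_×_; _,_; Σ; ∃; proj₁; proj₂)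
open import Data.Sum using (_⊎_; inj₁; inj₂)
open import Relation.Binary.PropositionalEquality using (_≡_; refl; sym; trans; subst)
open import Relation.Nullary using (¬_; yes; no)
open import Relation.Unary using (_∩_)

module _ {Var : Set} where

  ≐-sym : {X Y : FSet {Var}} → X ≐ Y → Y ≐ X
  ≐-sym (X⊆Y , Y⊆X) = Y⊆X , X⊆Y

  ≐-trans : {X Y Z : FSet {Var}} → X ≐ Y → Y ≐ Z → X ≐ Z
  ≐-trans (X⊆Y , Y⊆X) (Y⊆Z , Z⊆Y) =
    (λ φ x → Y⊆Z φ (X⊆Y φ x)) , (λ φ z → Y⊆X φ (Z⊆Y φ z))

  Meets-resp-≐ : ∀ A {X Y : FSet {Var}} → X ≐ Y → Meets A X → Meets A Y
  Meets-resp-≐ A (X⊆Y , _) (φ , φ∈A , φ∈X) = φ , φ∈A , X⊆Y φ φ∈X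

  ¬Meets-[] : (X : FSet {Var}) → ¬ Meets [] X
  ¬Meets-[] X (_ , () , _)

  closed-resp-≐ : ∀ {Cn} → IsConsequence Cn →
                  {X Y : FSet {Var}} → X ≐ Y → BeliefSet Cn Y → Cn X ≐ X
  closed-resp-≐ isCn {X} {Y} (X⊆Y , Y⊆X) (_ , CnY⊆Y) =
    (λ φ φ∈CnX → Y⊆X φ (CnY⊆Y φ (monotony X Y X⊆Y φ φ∈CnX))) , inclusion X
    where open IsConsequence isCn

  anyOf : Formula Var → List (Formula Var) → Desc
  anyOf φ []       = 𝔅 φ
  anyOf φ (ψ ∷ ψs) = 𝔅 φ ∨ᵈ anyOf ψ ψs

  ⊩-anyOf : ∀ φ φs (X : FSet {Var}) → Meets (φ ∷ φs) X → X ⊩ anyOf φ φs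
  ⊩-anyOf φ []       X (_ , here refl , φ∈X) = φ∈X
  ⊩-anyOf φ (ψ ∷ ψs) X (_ , here refl , φ∈X) = inj₁ φ∈X
  ⊩-anyOf φ (ψ ∷ ψs) X (χ , there χ∈ψs , χ∈X) = inj₂ (⊩-anyOf ψ ψs X (χ , χ∈ψs , χ∈X))

  anyOf-⊩ : ∀ φ φs (X : FSet {Var}) → X ⊩ anyOf φ φs → Meets (φ ∷ φs) X
  anyOf-⊩ φ []       X φ∈X        = φ , here refl , φ∈X
  anyOf-⊩ φ (ψ ∷ ψs) X (inj₁ φ∈X) = φ , here refl , φ∈X
  anyOf-⊩ φ (ψ ∷ ψs) X (inj₂ ⊩ψs) with anyOf-⊩ ψ ψs X ⊩ψs
  ... | χ , χ∈ψs , χ∈X = χ , there χ∈ψs , χ∈X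

module _ {W : Set} (_≤_ : W → W → Set) where

  Minimal-resp : {P Q : W → Set} → (∀ w → P w → Q w) → (∀ w → Q w → P w) →
                 ∀ {x} → Minimal _≤_ P x → Minimal _≤_ Q x
  Minimal-resp P⇒Q Q⇒P (Px , noneBelow) = P⇒Q _ Px , λ y Qy → noneBelow y (Q⇒P y Qy)

  HasUniqueMin-resp : {P Q : W → Set} → (∀ w → P w → Q w) → (∀ w → Q w → P w) →
                      HasUniqueMin _≤_ P → HasUniqueMin _≤_ Q
  HasUniqueMin-resp P⇒Q Q⇒P (x , minP , unique) =
    x , Minimal-resp P⇒Q Q⇒P minP , λ y minQ → unique y (Minimal-resp Q⇒P P⇒Q minQ)

  minimal-unique : {P : W → Set} → HasUniqueMin _≤_ P →
                   ∀ {x y} → Minimal _≤_ P x → Minimal _≤_ P y → x ≡ y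
  minimal-unique (_ , _ , unique) minX minY = trans (unique _ minX) (sym (unique _ minY))

  minimal-∩ : {P Q : W → Set} → ∀ {x} → Minimal _≤_ P x → Q x → Minimal _≤_ (P ∩ Q) x
  minimal-∩ (Px , noneBelow) Qx = (Px , Qx) , λ y PQy → noneBelow y (proj₁ PQy)

  least-minimal : {P : W → Set} → ∀ {k} → (∀ w → k ≤ w) → P k → Minimal _≤_ P k
  least-minimal k-least Pk = Pk , λ y _ y<k → proj₂ y<k (k-least y)

module RelModelProperties {Var : Set} {Cn : FSet {Var} → FSet} {K : FSet {Var}}
                          (M : RelModel Cn K) where
  open RelModel M

  describable-uniqueMin : ∀ {P : W → Set} (d : Desc) →
                          (∀ w → P w → 𝕏 w ⊩ d) → (∀ w → 𝕏 w ⊩ d → P w) →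
                          ∃ P → HasUniqueMin _≤_ P
  describable-uniqueMin {P} d P⇒d d⇒P (w , Pw) =
    HasUniqueMin-resp _≤_ (λ v ⊩Ψ → d⇒P v (⊩Ψ d refl)) P⇒Ψ (uniqueMin (_≡ d) (w , P⇒Ψ w Pw))
    where
    P⇒Ψ : ∀ v → P v → 𝕏 v ⊩ˢ (_≡ d)
    P⇒Ψ v Pv .d refl = P⇒d v Pv

  𝕏[]-uniqueMin : ∀ A → ∃ 𝕏[ A ] → HasUniqueMin _≤_ 𝕏[ A ]
  𝕏[]-uniqueMin []       (w , meets) = ⊥-elim (¬Meets-[] (𝕏 w) meets)
  𝕏[]-uniqueMin (φ ∷ φs) =
    describable-uniqueMin (anyOf φ φs) (λ w → ⊩-anyOf φ φs (𝕏 w)) (λ w → anyOf-⊩ φ φs (𝕏 w))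

  𝕏[]∩-uniqueMin : ∀ A B → ∃ (𝕏[ A ] ∩ 𝕏[ B ]) → HasUniqueMin _≤_ (𝕏[ A ] ∩ 𝕏[ B ])
  𝕏[]∩-uniqueMin []       B        (w , meets , _) = ⊥-elim (¬Meets-[] (𝕏 w) meets)
  𝕏[]∩-uniqueMin (φ ∷ φs) []       (w , _ , meets) = ⊥-elim (¬Meets-[] (𝕏 w) meets)
  𝕏[]∩-uniqueMin (φ ∷ φs) (ψ ∷ ψs) =
    describable-uniqueMin (anyOf φ φs ∧ᵈ anyOf ψ ψs)
      (λ w m → ⊩-anyOf φ φs (𝕏 w) (proj₁ m) , ⊩-anyOf ψ ψs (𝕏 w) (proj₂ m))
      (λ w ⊩d → anyOf-⊩ φ φs (𝕏 w) (proj₁ ⊩d) , anyOf-⊩ ψ ψs (𝕏 w) (proj₂ ⊩d))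

module ChoiceRevision (lem : ExcludedMiddle 0ℓ)
  {Var : Set} {Cn : FSet {Var} → FSet} (isCn : IsConsequence Cn)
  {K : FSet {Var}} (M : RelModel Cn K)
  (∗ : List (Formula Var) → FSet {Var}) (det : DeterminedBy M ∗) where
  open RelModel M
  open DeterminedBy det
  open RelModelProperties M

  Selects : List (Formula Var) → W → Set
  Selects A m = Minimal _≤_ 𝕏[ A ] m × (∗ A ≐ 𝕏 m)

  data Outcome (A : List (Formula Var)) : Set where
    unchanged : ¬ ∃ 𝕏[ A ] → ∗ A ≐ K → Outcome A
    selected  : ∀ m → Selects A m → Outcome A

  outcome : ∀ A → Outcome A
  outcome A with lem {∃ 𝕏[ A ]}
  ... | no  none = unchanged none (case-else A (inj₂ none))
  outcome []       | yes (w , meets) = ⊥-elim (¬Meets-[] (𝕏 w) meets)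
  outcome (φ ∷ φs) | yes nonempty with 𝕏[]-uniqueMin (φ ∷ φs) nonempty
  ... | m , minimal , _ = selected m (minimal , case-min (φ ∷ φs) (λ ()) m minimal)

  ∗-in-𝕏 : ∀ A → Σ W λ w → ∗ A ≐ 𝕏 w
  ∗-in-𝕏 A with outcome A
  ... | unchanged _ ∗A≐K      = k , ≐-trans ∗A≐K (≐-sym 𝕏k≐K)
  ... | selected m (_ , ∗A≐m) = m , ∗A≐m

  meets-∗⇒selects : ∀ A B → Meets A (∗ B) → Σ W (Selects A)
  meets-∗⇒selects A B meets with outcome A
  ... | selected m sel = m , sel
  ... | unchanged none _ with ∗-in-𝕏 B
  ... | w , ∗B≐w = ⊥-elim (none (w , Meets-resp-≐ A ∗B≐w meets))

  ∗-closure : ∀ A → Cn (∗ A) ≐ ∗ A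
  ∗-closure A with ∗-in-𝕏 A
  ... | w , ∗A≐w = closed-resp-≐ isCn ∗A≐w (belief w)

  ∗-relative-success : ∀ A → (∗ A ≐ K) ⊎ Meets A (∗ A)
  ∗-relative-success A with outcome A
  ... | unchanged _ ∗A≐K             = inj₁ ∗A≐K
  ... | selected m (minimal , ∗A≐m) = inj₂ (Meets-resp-≐ A (≐-sym ∗A≐m) (proj₁ minimal))

  ∗-regularity : ∀ A B → Meets A (∗ B) → Meets A (∗ A)
  ∗-regularity A B meets with meets-∗⇒selects A B meets
  ... | m , minimal , ∗A≐m = Meets-resp-≐ A (≐-sym ∗A≐m) (proj₁ minimal)

  ∗-confirmation : ∀ A → Meets A K → ∗ A ≐ K
  ∗-confirmation A meetsK with meets-∗⇒selects A [] (Meets-resp-≐ A (≐-sym ∗[]≐K) meetsK)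
    where ∗[]≐K = case-else [] (inj₁ refl)
  ... | m , minimal , ∗A≐m = ≐-trans ∗A≐m (subst (λ w → 𝕏 w ≐ K) k≡m 𝕏k≐K)
    where
    k-minimal : Minimal _≤_ 𝕏[ A ] k
    k-minimal = least-minimal _≤_ k-least (Meets-resp-≐ A (≐-sym 𝕏k≐K) meetsK)
    k≡m : k ≡ m
    k≡m = minimal-unique _≤_ (𝕏[]-uniqueMin A (k , proj₁ k-minimal)) k-minimal minimal

  ∗-reciprocity : ∀ A B → Meets B (∗ A) → Meets A (∗ B) → ∗ A ≐ ∗ B
  ∗-reciprocity A B B∩∗A A∩∗B
    with meets-∗⇒selects A B A∩∗B | meets-∗⇒selects B A B∩∗A
  ... | a , minA , ∗A≐a | b , minB , ∗B≐b =
    ≐-trans ∗A≐a (subst (λ w → 𝕏 w ≐ ∗ B) (sym a≡b) (≐-sym ∗B≐b))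
    where
    a-minimal : Minimal _≤_ (𝕏[ A ] ∩ 𝕏[ B ]) a
    a-minimal = minimal-∩ _≤_ minA (Meets-resp-≐ B ∗A≐a B∩∗A)
    b-minimal : Minimal _≤_ (𝕏[ A ] ∩ 𝕏[ B ]) b
    b-minimal = Minimal-resp _≤_ (λ _ m → proj₂ m , proj₁ m) (λ _ m → proj₂ m , proj₁ m)
                  (minimal-∩ _≤_ minB (Meets-resp-≐ A ∗B≐b A∩∗B))
    a≡b : a ≡ b
    a≡b = minimal-unique _≤_ (𝕏[]∩-uniqueMin A B (a , proj₁ a-minimal)) a-minimal b-minimal

mainTheorem1 : ExcludedMiddle 0ℓ →
    {Var : Set} (Cn : FSet {Var} → FSet) → IsConsequence Cn →
    (K : FSet {Var}) → BeliefSet Cn K → Consistent K →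
    (M : RelModel Cn K) (∗ : List (Formula Var) → FSet {Var}) → DeterminedBy M ∗ →
    ∀ (A B : List (Formula Var)) →
      (Cn (∗ A) ≐ ∗ A)
      × ((∗ A ≐ K) ⊎ Meets A (∗ A))
      × (Meets A (∗ B) → Meets A (∗ A))
      × (Meets A K → ∗ A ≐ K)
      × (Meets B (∗ A) → Meets A (∗ B) → ∗ A ≐ ∗ B)
mainTheorem1 lem Cn isCn K _ _ M ∗ det A B =
  ∗-closure A , ∗-relative-success A , ∗-regularity A B , ∗-confirmation A , ∗-reciprocity A B
  where open ChoiceRevision lem isCn M ∗ det
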